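{- Let $d\ge0$ and let $M$ be a finite structure in a language $\mathcal{L}$ containing a binary relation symbol $<$ such that $(M,<)$ is a partial order of width $2^{d+1}-1$. Then $M$ has the VCd property. Equivalently, a finite structure whose $<$-reduct is a partial order of width $n\ge1$ has the VCd property for $d=\lfloor\log_2(n)\rfloor$.
   Context: A partial order has width $n$ if every antichain has at most $n$ elements. For a set $\Delta(x;y)$ of partitioned $\mathcal{L}$-formulas and $B\subseteq M^{|y|}$, $S^\Delta(B)$ denotes the set of $\Delta$-types over $B$ (maximal consistent sets of formulas $\phi(x;b)$, $\neg\phi(x;b)$, $\phi\in\Delta$, $b\in B$). A family $(\phi_\#(y))_{\phi\in\Delta}$ of formulas with parameters defines $q\in S^\Delta(B)$ if for all $\phi\in\Delta$, $b\in B$: $\phi(x;b)\in q\iff M\models\phi_\#(b)$. $\Delta(x;y)$ has UDTFS in $d$ parameters in $M$ if there are finitely many families $\mathcal{F}_i=(\phi_i(y;y_1,\dots,y_d))_{\phi\in\Delta}$, $i\le m$, of $\mathcal{L}$-formulas with $|y_j|=|y|$, such that for every finite $B\subseteq M^{|y|}$ and $q\in S^\Delta(B)$ there are $b_1,\dots,b_d\in B$ and $i\le m$ with $\mathcal{F}_i(y;b_1,\dots,b_d)$ defining $q$. $M$ has the VCd property if every finite $\Delta(x;y)$ with $|x|=1$ has UDTFS in $d$ parameters. -}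

module Defs where

open import Data.Nat using (ℕ; _≤_; _∸_; _^_; suc)
open import Data.Fin using (Fin)
open import Data.Bool using (Bool; true)
open import Data.Vec using (Vec; []; _∷_)
open import Data.List using (List; length; lookup; _∷_)
open import Data.List.Relation.Unary.All using (All)
open import Data.List.Relation.Unary.Unique.Propositional using (Unique)
open import Data.List.Relation.Unary.AllPairs using (AllPairs)
open import Data.Maybe using (Maybe; just; nothing)
open import Data.Sum using (_⊎_; inj₁; inj₂)
open import Data.Unit using (⊤)
open import Data.Product using (Σ; _×_; ∃; _,_)
open import Data.Empty using (⊥)
open import Relation.Nullary using (¬_)
open import Relation.Binary.PropositionalEquality using (_≡_)
open import Function.Bundles using (_⇔_)

record Language : Set₁ where
  field
    Fun : ℕ → Set
    Rel : ℕ → Set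
open Language public

data Term (L : Language) (V : Set) : Set where
  var : V → Term L V
  fun : ∀ {k} → Fun L k → Vec (Term L V) k → Term L V

data Formula (L : Language) (V : Set) : Set where
  rel   : ∀ {k} → Rel L k → Vec (Term L V) k → Formula L V
  _≐_   : Term L V → Term L V → Formula L V
  ⊥f ⊤f : Formula L V
  ¬f_   : Formula L V → Formula L V
  _∧f_ _∨f_ _⇒f_ : Formula L V → Formula L V → Formula L V
  ∃f ∀f : Formula L (Maybe V) → Formula L V

-- A finite L-structure, with universe Fin N (finite structures up to
-- isomorphism).  Relations are interpreted as (classical) Bool-valued
-- predicates.
record Structure (L : Language) : Set₁ where
  field
    N    : ℕ
    funI : ∀ {k} → Fun L k → Vec (Fin N) k → Fin N
    relI : ∀ {k} → Rel L k → Vec (Fin N) k → Bool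
open Structure public

module _ {L : Language} (M : Structure L) where

  private U = Fin (N M)

  mutual
    evalT : {V : Set} → (V → U) → Term L V → U
    evalT ρ (var v)    = ρ v
    evalT ρ (fun f ts) = funI M f (evalTs ρ ts)

    evalTs : {V : Set} {k : ℕ} → (V → U) → Vec (Term L V) k → Vec U k
    evalTs ρ []       = []
    evalTs ρ (t ∷ ts) = evalT ρ t ∷ evalTs ρ ts

  extend : {V : Set} → (V → U) → U → Maybe V → U
  extend ρ a (just v) = ρ v
  extend ρ a nothing  = a

  Sat : {V : Set} → (V → U) → Formula L V → Set
  Sat ρ (rel R ts) = relI M R (evalTs ρ ts) ≡ true
  Sat ρ (s ≐ t)    = evalT ρ s ≡ evalT ρ t
  Sat ρ ⊥f         = ⊥
  Sat ρ ⊤f         = ⊤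
  Sat ρ (¬f φ)     = ¬ Sat ρ φ
  Sat ρ (φ ∧f ψ)   = Sat ρ φ × Sat ρ ψ
  Sat ρ (φ ∨f ψ)   = Sat ρ φ ⊎ Sat ρ ψ
  Sat ρ (φ ⇒f ψ)   = Sat ρ φ → Sat ρ ψ
  Sat ρ (∃f φ)     = Σ U (λ a → Sat (extend ρ a) φ)
  Sat ρ (∀f φ)     = (a : U) → Sat (extend ρ a) φ

  -- A partitioned formula φ(x;y) with |x| = 1, |y| = k has free variables
  -- from  ⊤ ⊎ Fin k  (inj₁ _ is x, inj₂ i is y_i).  A finite set Δ(x;y) is
  -- a family  Fin n → Formula L (⊤ ⊎ Fin k).

  Tuple : ℕ → Set
  Tuple k = Fin k → U

  envXY : ∀ {k} → U → Tuple k → (⊤ ⊎ Fin k) → U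
  envXY a b (inj₁ _) = a
  envXY a b (inj₂ i) = b i

  -- q ∈ S^Δ(B): q j b  stands for "Δ j (x;b) ∈ q" (for b ∈ B; otherwise
  -- ¬Δ j (x;b) ∈ q, by maximality).  Consistency with Th(M) of this finite
  -- set of formulas means its conjunction is satisfiable in M, i.e. some
  -- a ∈ M realizes it.
  IsDeltaType : ∀ {k n} → (Fin n → Formula L (⊤ ⊎ Fin k)) →
                List (Tuple k) → (Fin n → Tuple k → Set) → Set
  IsDeltaType Δ B q =
    Σ U λ a → (j : Fin _) → All (λ b → q j b ⇔ Sat (envXY a b) (Δ j)) B

  -- Formulas φ_#(y; y_1,…,y_d): free variables Fin k ⊎ (Fin d × Fin k);
  -- inj₁ i is y_i, inj₂ (r , i) is the i-th coordinate of y_{r+1}.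
  envPar : ∀ {k d} → Tuple k → (Fin d → Tuple k) → (Fin k ⊎ (Fin d × Fin k)) → U
  envPar b bs (inj₁ i)       = b i
  envPar b bs (inj₂ (r , i)) = bs r i

  Defines : ∀ {k n d} → (Fin n → Formula L (Fin k ⊎ (Fin d × Fin k))) →
            (Fin d → Tuple k) → List (Tuple k) → (Fin n → Tuple k → Set) → Set
  Defines F bs B q = (j : Fin _) → All (λ b → q j b ⇔ Sat (envPar b bs) (F j)) B

  -- Δ(x;y) has UDTFS in d parameters in M.  Finite B ⊆ M^k are given as
  -- (nonempty) lists; the parameters b_1,…,b_d ∈ B are given by positions
  -- in the list.
  UDTFS : ∀ {k n} → ℕ → (Fin n → Formula L (⊤ ⊎ Fin k)) → Set₁
  UDTFS {k} {n} d Δ =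
    Σ ℕ λ m → Σ (Fin m → Fin n → Formula L (Fin k ⊎ (Fin d × Fin k))) λ F →
      (B : List (Tuple k)) → 0 Data.Nat.< length B →
      (q : Fin n → Tuple k → Set) → IsDeltaType Δ B q →
      Σ (Fin d → Fin (length B)) λ idx → Σ (Fin m) λ i →
        Defines (F i) (λ r → lookup B (idx r)) B q

  VCd : ℕ → Set₁
  VCd d = (k n : ℕ) (Δ : Fin n → Formula L (⊤ ⊎ Fin k)) → UDTFS d Δ

module _ {L : Language} (M : Structure L) (lt : Rel L 2) where

  _<ᴹ_ : Fin (N M) → Fin (N M) → Set
  a <ᴹ b = relI M lt (a ∷ b ∷ []) ≡ true

  IsStrictPO : Set
  IsStrictPO = (∀ a → ¬ (a <ᴹ a)) × (∀ a b c → a <ᴹ b → b <ᴹ c → a <ᴹ c)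

  Incomparable : Fin (N M) → Fin (N M) → Set
  Incomparable a b = ¬ (a <ᴹ b) × ¬ (b <ᴹ a)

  WidthAtMost : ℕ → Set
  WidthAtMost w = (as : List (Fin (N M))) → Unique as →
                  AllPairs Incomparable as → length as ≤ w

-- Let q = tp_Δ(a/B) and let G_P be the group of automorphisms of the (finite) reduct of M to =, <
-- and Δ that fix the tuples of P ⊆ B pointwise.  If some σ ∈ G_P moves b ∈ B to b′ ∈ B although
-- Δ_j(a; b) ∧ ¬Δ_j(a; b′), then σ maps the G_{P,b}-orbit of a injectively into the part of the
-- G_P-orbit satisfying Δ_j(x; b′), while the G_{P,b′}-orbit lies in the part satisfying ¬Δ_j(x; b′);
-- so adding b or b′ to P at least halves the orbit.  The G_∅-orbit of a is an antichain (an
-- automorphism of a finite order cannot move a point strictly up), hence has fewer than 2^(d+1)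
-- elements, and after d steps q is G_P-invariant for some d-element P.  Then for b ∈ B,
-- Δ_j(a; b) holds iff b = σ b₀ with σ ∈ G_P and b₀ ∈ B satisfying Δ_j(a; b₀), which is first-order
-- in the parameters P: σ is described by |M| existential variables and the finitely many
-- formulas stating that it preserves =, < and Δ.

module Submission where

open import Defs
open import Data.Nat using (ℕ; zero; suc; _+_; _*_; _^_; _∸_; _≤_; _<_; _<?_; z≤n; z<s)
open import Data.Nat.Properties
  using (1+n≰n; n<1+n; m<1+n⇒m<n∨m≡n; <-irrefl; ≤-trans; ≤-<-trans; ≮⇒≥; ∸-monoʳ-<; m^n>0;
         +-suc; +-identityʳ; +-cancelˡ-<; +-monoˡ-≤; +-mono-≤; module ≤-Reasoning)
open import Data.Fin using (Fin; zero; suc; _≟_; toℕ; fromℕ<; punchOut; combine; remQuot; finToFun; funToFin)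
import Data.Fin as Fin
open import Data.Fin.Properties
  using (any?; all?; pigeonhole; punchOut-injective; injective⇒≤; remQuot-combine; finToFun-funToFin)
open import Data.Bool using (true)
import Data.Bool as Bool
open import Data.Vec using (Vec; []; _∷_)
import Data.Vec as Vec
import Data.Vec.Relation.Unary.All.Properties as VecAll
import Data.Vec.Functional as VF
open import Data.Maybe using (Maybe; just; nothing)
import Data.Maybe as Maybe
open import Data.Sum using (_⊎_; inj₁; inj₂; [_,_])
open import Data.Unit using (⊤; tt)
open import Data.Product using (Σ; _×_; ∃; ∃₂; _,_; proj₁; proj₂; uncurry)
open import Data.Product.Function.NonDependent.Propositional using (_×-⇔_)
open import Data.Sum.Function.Propositional using (_⊎-⇔_)
open import Data.Empty using (⊥-elim)
open import Relation.Nullary using (¬_; Dec; yes; no; contradiction)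
open import Relation.Nullary.Decidable
  using (¬?; _×-dec_; _⊎-dec_; _→-dec_; map′; decidable-stable)
open import Data.List using (List; []; _∷_; _++_; length; filter; allFin)
import Data.List as List
open import Data.List.Properties using (length-map; filter-notAll; ++-identityʳ)
open import Data.List.Relation.Unary.All using (All; []; _∷_)
import Data.List.Relation.Unary.All as All
open import Data.List.Relation.Unary.All.Properties using (all-filter)
import Data.List.Relation.Unary.All.Properties as All
open import Data.List.Relation.Unary.Any using (here; there)
import Data.List.Relation.Unary.Any as Any
open import Data.List.Relation.Unary.Any.Properties using (lookup-index)
open import Data.List.Relation.Unary.Unique.Propositional using (Unique)
open import Data.List.Relation.Unary.AllPairs using (AllPairs; []; _∷_)
import Data.List.Relation.Unary.Unique.Propositional.Properties as Unique
open import Data.List.Relation.Binary.Subset.Propositional using (_⊆_)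
open import Data.List.Membership.Propositional.Properties using (∈-filter⁺; ∈-allFin; ∈-++⁺ʳ)
open import Data.List.Relation.Binary.Permutation.Propositional.Properties
  using (∈-resp-↭) renaming (shift to ↭-shift)
open import Relation.Binary.PropositionalEquality
  using (_≡_; _≢_; _≗_; refl; sym; trans; cong; cong₂; subst)
open import Relation.Binary.Definitions using (DecidableEquality)
open import Relation.Unary using (Decidable)
open import Function.Definitions using (Injective; StrictlySurjective)
open import Function using (_∘_; id)
open import Function.Bundles using (_⇔_; mk⇔; Equivalence)
open import Function.Properties.Equivalence
  using () renaming (refl to ⇔-refl; sym to ⇔-sym; trans to ⇔-trans)
open import Function.Related.TypeIsomorphisms using (→-cong-⇔; ¬-cong-⇔)
open import Function.Construct.Composition using (_⇔-∘_)

open Equivalence using (to; from)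

≡⇒⇔ : {A B : Set} → A ≡ B → A ⇔ B
≡⇒⇔ refl = ⇔-refl

Σ-⇔ : {A : Set} {P Q : A → Set} → (∀ a → P a ⇔ Q a) → Σ A P ⇔ Σ A Q
Σ-⇔ P⇔Q = mk⇔ (λ (a , p) → a , to (P⇔Q a) p) (λ (a , q) → a , from (P⇔Q a) q)

Π-⇔ : {A : Set} {P Q : A → Set} → (∀ a → P a ⇔ Q a) → (∀ a → P a) ⇔ (∀ a → Q a)
Π-⇔ P⇔Q = mk⇔ (λ p a → to (P⇔Q a) (p a)) (λ q a → from (P⇔Q a) (q a))

-- Finite combinatorics

injective⇒strictlySurjective : {n : ℕ} {f : Fin n → Fin n} →
                               Injective _≡_ _≡_ f → StrictlySurjective _≡_ f
injective⇒strictlySurjective {suc n} {f} f-inj y with any? (λ x → f x ≟ y)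
... | yes hit  = hit
... | no ¬hit = contradiction (injective⇒≤ avoid-y-injective) 1+n≰n
  where
    f≢y : ∀ x → f x ≢ y
    f≢y x fx≡y = ¬hit (x , fx≡y)
    avoid-y : Fin (suc n) → Fin n
    avoid-y x = punchOut (f≢y x ∘ sym)
    avoid-y-injective : Injective _≡_ _≡_ avoid-y
    avoid-y-injective {x} {x′} eq = f-inj (punchOut-injective (f≢y x ∘ sym) (f≢y x′ ∘ sym) eq)

module _ {n : ℕ} {_≺_ : Fin n → Fin n → Set}
         (irrefl : ∀ x → ¬ x ≺ x) (≺-trans : ∀ x y z → x ≺ y → y ≺ z → x ≺ z) where

  -- Iterating g from x would give an infinite ≺-chain, which pigeonhole forbids.
  monotone⇒¬x≺gx : (g : Fin n → Fin n) → (∀ {x y} → x ≺ y → g x ≺ g y) → ∀ x → ¬ x ≺ g x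
  monotone⇒¬x≺gx g g-mono x x≺gx = noRepetition (pigeonhole (n<1+n n) (gⁱx ∘ toℕ))
    where
      gⁱx : ℕ → Fin n
      gⁱx zero    = x
      gⁱx (suc i) = g (gⁱx i)

      step : ∀ i → gⁱx i ≺ gⁱx (suc i)
      step zero    = x≺gx
      step (suc i) = g-mono (step i)

      climb : ∀ {i j} → i < j → gⁱx i ≺ gⁱx j
      climb {i} {suc j} i<1+j with m<1+n⇒m<n∨m≡n i<1+j
      ... | inj₁ i<j  = ≺-trans _ _ _ (climb i<j) (step j)
      ... | inj₂ refl = step i

      noRepetition : ¬ ∃₂ λ i j → i Fin.< j × gⁱx (toℕ i) ≡ gⁱx (toℕ j)
      noRepetition (i , j , i<j , gⁱx≡gʲx) =
        irrefl _ (subst (gⁱx (toℕ i) ≺_) (sym gⁱx≡gʲx) (climb i<j))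

anyFunction? : {m n : ℕ} {P : (Fin m → Fin n) → Set} → (∀ {f g} → f ≗ g → P f → P g) →
               (∀ f → Dec (P f)) → Dec (∃ P)
anyFunction? P-resp P? with any? (P? ∘ finToFun)
... | yes (i , p) = yes (finToFun i , p)
... | no ¬p       = no λ (f , pf) → ¬p (funToFin f , P-resp (sym ∘ finToFun-funToFin f) pf)

module _ {A : Set} (_≟ᴬ_ : DecidableEquality A) where

  unique⊆⇒length≤ : {xs ys : List A} → Unique xs → xs ⊆ ys → length xs ≤ length ys
  unique⊆⇒length≤ {[]}     _            _     = z≤n
  unique⊆⇒length≤ {x ∷ xs} {ys} (x∉xs ∷ xs!) xs⊆ys = ≤-<-trans
    (unique⊆⇒length≤ xs! λ z∈xs →
      ∈-filter⁺ (¬? ∘ (x ≟ᴬ_)) (xs⊆ys (there z∈xs)) (All.lookup x∉xs z∈xs))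
    (filter-notAll (¬? ∘ (x ≟ᴬ_)) ys (Any.map (λ x≡z x≢z → x≢z x≡z) (xs⊆ys (here refl))))

module Counting {n : ℕ} where

  count : {P : Fin n → Set} → Decidable P → ℕ
  count P? = length (filter P? (allFin n))

  unique⇒length≤count : {P : Fin n → Set} (P? : Decidable P) {xs : List (Fin n)} →
                        Unique xs → All P xs → length xs ≤ count P?
  unique⇒length≤count P? xs! ps = unique⊆⇒length≤ _≟_ xs!
    λ x∈xs → ∈-filter⁺ P? (∈-allFin _) (All.lookup ps x∈xs)

  module _ {P : Fin n → Set} (P? : Decidable P) where

    count-injective : {Q : Fin n → Set} (Q? : Decidable Q) (f : Fin n → Fin n) →
                      Injective _≡_ _≡_ f → (∀ {x} → P x → Q (f x)) → count P? ≤ count Q?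
    count-injective Q? f f-inj P⇒Q∘f = subst (_≤ count Q?) (length-map f (filter P? (allFin n)))
      (unique⇒length≤count Q? (Unique.map⁺ f-inj (Unique.filter⁺ P? (Unique.allFin⁺ n)))
                              (All.map⁺ (All.map P⇒Q∘f (all-filter P? (allFin n)))))

    count-mono : {Q : Fin n → Set} (Q? : Decidable Q) → (∀ {x} → P x → Q x) → count P? ≤ count Q?
    count-mono Q? = count-injective Q? id id

    count-split : {R : Fin n → Set} (R? : Decidable R) →
                  count P? ≡ count (λ x → P? x ×-dec R? x) + count (λ x → P? x ×-dec ¬? (R? x))
    count-split R? = split (allFin n)
      where
        split : (xs : List (Fin n)) →
                length (filter P? xs) ≡ length (filter (λ x → P? x ×-dec R? x) xs)
                                      + length (filter (λ x → P? x ×-dec ¬? (R? x)) xs)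
        split [] = refl
        split (x ∷ xs) with P? x | R? x
        ... | yes _ | yes _ = cong suc (split xs)
        ... | yes _ | no _  = trans (cong suc (split xs)) (sym (+-suc _ _))
        ... | no _  | _     = split xs

m+n<2*o⇒m<o⊎n<o : ∀ {m n} o → m + n < 2 * o → m < o ⊎ n < o
m+n<2*o⇒m<o⊎n<o {m} {n} o m+n<2o with m <? o
... | yes m<o = inj₁ m<o
... | no m≮o  = inj₂ (+-cancelˡ-< o n o (begin-strict
  o + n       ≤⟨ +-monoˡ-≤ n (≮⇒≥ m≮o) ⟩
  m + n       <⟨ m+n<2o ⟩
  2 * o       ≡⟨ cong (o +_) (+-identityʳ o) ⟩
  o + o       ∎))
  where open ≤-Reasoning

All⇒AllPairs : {A : Set} {P : A → Set} {R : A → A → Set} → (∀ {x y} → P x → P y → R x y) →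
               {xs : List A} → All P xs → AllPairs R xs
All⇒AllPairs P⇒R []       = []
All⇒AllPairs P⇒R (p ∷ ps) = All.map (P⇒R p) ps ∷ All⇒AllPairs P⇒R ps

toBit : {P : Set} → Dec P → Fin 2
toBit (yes _) = suc zero
toBit (no _)  = zero

toBit-sound : {P : Set} (P? : Dec P) → toBit P? ≡ suc zero → P
toBit-sound (yes p) _ = p

toBit-complete : {P : Set} (P? : Dec P) → P → toBit P? ≡ suc zero
toBit-complete (yes _) _ = refl
toBit-complete (no ¬p) p = contradiction p ¬p

decode₂ : {p q r : ℕ} → Fin ((r ^ q) ^ p) → Fin p → Fin q → Fin r
decode₂ {p} {q} {r} i x = finToFun {r} {q} (finToFun {r ^ q} {p} i x)

encode₂ : {p q r : ℕ} → (Fin p → Fin q → Fin r) → Fin ((r ^ q) ^ p)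
encode₂ f = funToFin (funToFin ∘ f)

decode₂-encode₂ : {p q r : ℕ} (f : Fin p → Fin q → Fin r) →
                  ∀ x y → decode₂ (encode₂ f) x y ≡ f x y
decode₂-encode₂ f x y = trans (cong (λ g → finToFun g y) (finToFun-funToFin (funToFin ∘ f) x))
                              (finToFun-funToFin (f x) y)

-- Renaming, decidability, and formulas defining automorphisms

module Semantics {L : Language} (M : Structure L) where

  private
    U = Fin (N M)

  mutual
    renameTerm : {V W : Set} → (V → W) → Term L V → Term L W
    renameTerm f (var v)    = var (f v)
    renameTerm f (fun g ts) = fun g (renameTerms f ts)

    renameTerms : {V W : Set} {k : ℕ} → (V → W) → Vec (Term L V) k → Vec (Term L W) k
    renameTerms f []       = []
    renameTerms f (t ∷ ts) = renameTerm f t ∷ renameTerms f ts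

  rename : {V W : Set} → (V → W) → Formula L V → Formula L W
  rename f (rel R ts) = rel R (renameTerms f ts)
  rename f (s ≐ t)    = renameTerm f s ≐ renameTerm f t
  rename f ⊥f         = ⊥f
  rename f ⊤f         = ⊤f
  rename f (¬f φ)     = ¬f rename f φ
  rename f (φ ∧f ψ)   = rename f φ ∧f rename f ψ
  rename f (φ ∨f ψ)   = rename f φ ∨f rename f ψ
  rename f (φ ⇒f ψ)   = rename f φ ⇒f rename f ψ
  rename f (∃f φ)     = ∃f (rename (Maybe.map f) φ)
  rename f (∀f φ)     = ∀f (rename (Maybe.map f) φ)

  module _ {V W : Set} (f : V → W) {ρ : W → U} {ρ′ : V → U} (ρ∘f≗ρ′ : ρ ∘ f ≗ ρ′) where
    mutual
      evalT-rename : (t : Term L V) → evalT M ρ (renameTerm f t) ≡ evalT M ρ′ t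
      evalT-rename (var v)    = ρ∘f≗ρ′ v
      evalT-rename (fun g ts) = cong (funI M g) (evalTs-rename ts)

      evalTs-rename : {k : ℕ} (ts : Vec (Term L V) k) → evalTs M ρ (renameTerms f ts) ≡ evalTs M ρ′ ts
      evalTs-rename []       = refl
      evalTs-rename (t ∷ ts) = cong₂ _∷_ (evalT-rename t) (evalTs-rename ts)

  extend-map : {V W : Set} (f : V → W) {ρ : W → U} {ρ′ : V → U} → ρ ∘ f ≗ ρ′ →
               ∀ a → extend M ρ a ∘ Maybe.map f ≗ extend M ρ′ a
  extend-map f ρ∘f≗ρ′ a (just v) = ρ∘f≗ρ′ v
  extend-map f ρ∘f≗ρ′ a nothing  = refl

  Sat-rename : {V W : Set} (f : V → W) {ρ : W → U} {ρ′ : V → U} → ρ ∘ f ≗ ρ′ →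
               (φ : Formula L V) → Sat M ρ (rename f φ) ⇔ Sat M ρ′ φ
  Sat-rename f e (rel R ts) = ≡⇒⇔ (cong (λ v → relI M R v ≡ true) (evalTs-rename f e ts))
  Sat-rename f e (s ≐ t)    = ≡⇒⇔ (cong₂ _≡_ (evalT-rename f e s) (evalT-rename f e t))
  Sat-rename f e ⊥f         = ⇔-refl
  Sat-rename f e ⊤f         = ⇔-refl
  Sat-rename f e (¬f φ)     = ¬-cong-⇔ (Sat-rename f e φ)
  Sat-rename f e (φ ∧f ψ)   = Sat-rename f e φ ×-⇔ Sat-rename f e ψ
  Sat-rename f e (φ ∨f ψ)   = Sat-rename f e φ ⊎-⇔ Sat-rename f e ψ
  Sat-rename f e (φ ⇒f ψ)   = →-cong-⇔ (Sat-rename f e φ) (Sat-rename f e ψ)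
  Sat-rename f e (∃f φ)     = Σ-⇔ λ a → Sat-rename (Maybe.map f) (extend-map f e a) φ
  Sat-rename f e (∀f φ)     = Π-⇔ λ a → Sat-rename (Maybe.map f) (extend-map f e a) φ

  Sat-cong : {V : Set} {ρ ρ′ : V → U} → ρ ≗ ρ′ → (φ : Formula L V) → Sat M ρ φ ⇔ Sat M ρ′ φ
  Sat-cong ρ≗ρ′ φ = ⇔-trans (⇔-sym (Sat-rename id (λ _ → refl) φ)) (Sat-rename id ρ≗ρ′ φ)

  Sat? : {V : Set} (ρ : V → U) (φ : Formula L V) → Dec (Sat M ρ φ)
  Sat? ρ (rel R ts) = relI M R (evalTs M ρ ts) Bool.≟ true
  Sat? ρ (s ≐ t)    = evalT M ρ s ≟ evalT M ρ t
  Sat? ρ ⊥f         = no id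
  Sat? ρ ⊤f         = yes tt
  Sat? ρ (¬f φ)     = ¬? (Sat? ρ φ)
  Sat? ρ (φ ∧f ψ)   = Sat? ρ φ ×-dec Sat? ρ ψ
  Sat? ρ (φ ∨f ψ)   = Sat? ρ φ ⊎-dec Sat? ρ ψ
  Sat? ρ (φ ⇒f ψ)   = Sat? ρ φ →-dec Sat? ρ ψ
  Sat? ρ (∃f φ)     = any? λ a → Sat? (extend M ρ a) φ
  Sat? ρ (∀f φ)     = all? λ a → Sat? (extend M ρ a) φ

  ⋀ : {V : Set} {n : ℕ} → (Fin n → Formula L V) → Formula L V
  ⋀ {n = zero}  φs = ⊤f
  ⋀ {n = suc n} φs = φs zero ∧f ⋀ (φs ∘ suc)

  Sat-⋀ : {V : Set} {n : ℕ} (ρ : V → U) (φs : Fin n → Formula L V) →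
          Sat M ρ (⋀ φs) ⇔ (∀ i → Sat M ρ (φs i))
  Sat-⋀ {n = zero}  ρ φs = mk⇔ (λ _ ()) (λ _ → tt)
  Sat-⋀ {n = suc n} ρ φs = mk⇔
    (λ { (p , ps) zero → p ; (p , ps) (suc i) → to (Sat-⋀ ρ (φs ∘ suc)) ps i })
    (λ ps → ps zero , from (Sat-⋀ ρ (φs ∘ suc)) (ps ∘ suc))

  ⋁ : {V : Set} {n : ℕ} → (Fin n → Formula L V) → Formula L V
  ⋁ {n = zero}  φs = ⊥f
  ⋁ {n = suc n} φs = φs zero ∨f ⋁ (φs ∘ suc)

  Sat-⋁ : {V : Set} {n : ℕ} (ρ : V → U) (φs : Fin n → Formula L V) →
          Sat M ρ (⋁ φs) ⇔ ∃ λ i → Sat M ρ (φs i)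
  Sat-⋁ {n = zero}  ρ φs = mk⇔ (λ ()) (λ ())
  Sat-⋁ {n = suc n} ρ φs = mk⇔
    (λ { (inj₁ p) → zero , p ; (inj₂ ps) → let (i , p) = to (Sat-⋁ ρ (φs ∘ suc)) ps in suc i , p })
    (λ { (zero , p) → inj₁ p ; (suc i , p) → inj₂ (from (Sat-⋁ ρ (φs ∘ suc)) (i , p)) })

  shiftVar : {V : Set} {n : ℕ} → V ⊎ Fin (suc n) → Maybe (V ⊎ Fin n)
  shiftVar (inj₁ v)       = just (inj₁ v)
  shiftVar (inj₂ zero)    = nothing
  shiftVar (inj₂ (suc i)) = just (inj₂ i)

  dropFin0 : {V : Set} → V ⊎ Fin 0 → V
  dropFin0 (inj₁ v) = v

  ∃ⁿ : {V : Set} (n : ℕ) → Formula L (V ⊎ Fin n) → Formula L V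
  ∃ⁿ zero    φ = rename dropFin0 φ
  ∃ⁿ (suc n) φ = ∃ⁿ n (∃f (rename shiftVar φ))

  Sat-∃ⁿ : {V : Set} (ρ : V → U) (n : ℕ) (φ : Formula L (V ⊎ Fin n)) →
           Sat M ρ (∃ⁿ n φ) ⇔ ∃ λ (xs : Fin n → U) → Sat M [ ρ , xs ] φ
  Sat-∃ⁿ ρ zero φ = mk⇔
    (λ p → noVars , to (Sat-rename dropFin0 (ρ∘drop≗ noVars) φ) p)
    (λ (xs , p) → from (Sat-rename dropFin0 (ρ∘drop≗ xs) φ) p)
    where
      noVars : Fin 0 → U
      noVars ()
      ρ∘drop≗ : (xs : Fin 0 → U) → ρ ∘ dropFin0 ≗ [ ρ , xs ]
      ρ∘drop≗ xs (inj₁ v) = refl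
  Sat-∃ⁿ ρ (suc n) φ = ⇔-trans (Sat-∃ⁿ ρ n _) (mk⇔
    (λ (xs , x , p) → (x VF.∷ xs) , to (Sat-rename shiftVar uncons φ) p)
    (λ (xs , p) → (xs ∘ suc) , xs zero , from (Sat-rename shiftVar uncons φ) p))
    where
      uncons : {xs : Fin (suc n) → U} → extend M [ ρ , xs ∘ suc ] (xs zero) ∘ shiftVar ≗ [ ρ , xs ]
      uncons (inj₁ v)       = refl
      uncons (inj₂ zero)    = refl
      uncons (inj₂ (suc i)) = refl

  agreesWith : {V : Set} {P : Set} → Dec P → Formula L V → Formula L V
  agreesWith (yes _) φ = φ
  agreesWith (no _)  φ = ¬f φ

  Sat-agreesWith : {V : Set} {P : Set} (ρ : V → U) (P? : Dec P) (φ : Formula L V) →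
                   Sat M ρ (agreesWith P? φ) ⇔ (P ⇔ Sat M ρ φ)
  Sat-agreesWith ρ (yes p) φ = mk⇔ (λ s → mk⇔ (λ _ → s) (λ _ → p)) (λ e → to e p)
  Sat-agreesWith ρ (no ¬p) φ = mk⇔ (λ ¬s → mk⇔ (⊥-elim ∘ ¬p) (⊥-elim ∘ ¬s)) (λ e → ¬p ∘ from e)

  record Preserves {V : Set} (σ : U → U) (φ : Formula L V) : Set where
    constructor preserving
    field
      Sat-∘ : ∀ ρ → Sat M ρ φ ⇔ Sat M (σ ∘ ρ) φ

  open Preserves public

  module _ {V : Set} {φ : Formula L V} where

    Preserves-id : Preserves id φ
    Preserves-id = preserving λ _ → ⇔-refl

    Preserves-∘ : {σ τ : U → U} → Preserves σ φ → Preserves τ φ → Preserves (σ ∘ τ) φ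
    Preserves-∘ {τ = τ} σφ τφ = preserving λ ρ → ⇔-trans (Sat-∘ τφ ρ) (Sat-∘ σφ (τ ∘ ρ))

    Preserves-cong : {σ τ : U → U} → σ ≗ τ → Preserves σ φ → Preserves τ φ
    Preserves-cong σ≗τ σφ = preserving λ ρ → ⇔-trans (Sat-∘ σφ ρ) (Sat-cong (σ≗τ ∘ ρ) φ)

    Preserves-inverse : {σ σ⁻ : U → U} → σ ∘ σ⁻ ≗ id → Preserves σ φ → Preserves σ⁻ φ
    Preserves-inverse {σ⁻ = σ⁻} inverse σφ = preserving λ ρ →
      ⇔-sym (⇔-trans (Sat-∘ σφ (σ⁻ ∘ ρ)) (Sat-cong (inverse ∘ ρ) φ))

  valuation : {m : ℕ} → Fin (N M ^ suc m) → ⊤ ⊎ Fin m → U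
  valuation {m} u = envXY M (w zero) (w ∘ suc)
    where
      w : Fin (suc m) → U
      w = finToFun {N M} {suc m} u

  valuation-onto : {m : ℕ} (ρ : ⊤ ⊎ Fin m → U) → ∃ λ u → valuation u ≗ ρ
  valuation-onto {m} ρ = u , λ { (inj₁ tt) → decode zero ; (inj₂ i) → decode (suc i) }
    where
      w : Fin (suc m) → U
      w zero    = ρ (inj₁ tt)
      w (suc i) = ρ (inj₂ i)
      u : Fin (N M ^ suc m)
      u = funToFin w
      decode : finToFun {N M} {suc m} u ≗ w
      decode = finToFun-funToFin w

  -- The free variable u of  preservedBy φ  stands for the image of u under a map U → U.
  preservedBy : {m : ℕ} → Formula L (⊤ ⊎ Fin m) → Formula L U
  preservedBy φ = ⋀ λ u → agreesWith (Sat? (valuation u) φ) (rename (valuation u) φ)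

  Sat-preservedBy : {m : ℕ} (σ : U → U) (φ : Formula L (⊤ ⊎ Fin m)) →
                    Sat M σ (preservedBy φ) ⇔ Preserves σ φ
  Sat-preservedBy σ φ = ⇔-trans (Sat-⋀ σ _) (mk⇔
    (λ agree → preserving λ ρ → let (u , u≗ρ) = valuation-onto ρ in
      ⇔-trans (Sat-cong (sym ∘ u≗ρ) φ)
     (⇔-trans (to (Sat-agreesWith σ _ _) (agree u))
     (⇔-trans (Sat-rename (valuation u) (λ _ → refl) φ)
              (Sat-cong (cong σ ∘ u≗ρ) φ))))
    (λ pres u → from (Sat-agreesWith σ _ _)
      (⇔-trans (Sat-∘ pres (valuation u)) (⇔-sym (Sat-rename (valuation u) (λ _ → refl) φ)))))

-- Orbits of automorphisms of the reduct to =, < and Δ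

module Reduct {L : Language} (M : Structure L) (lt : Rel L 2)
              {k n : ℕ} (Δ : Fin n → Formula L (⊤ ⊎ Fin k)) where

  open Semantics M
  open Counting

  private
    U = Fin (N M)

  _≺_ : U → U → Set
  _≺_ = _<ᴹ_ M lt

  ≐φ <φ : Formula L (⊤ ⊎ Fin 1)
  ≐φ = var (inj₁ tt) ≐ var (inj₂ zero)
  <φ = rel lt (var (inj₁ tt) ∷ var (inj₂ zero) ∷ [])

  <φ-preserved : {σ : U → U} → Preserves σ <φ → ∀ x y → x ≺ y ⇔ σ x ≺ σ y
  <φ-preserved σ< x y = Sat-∘ σ< (envXY M x λ _ → y)

  record IsAut (σ : U → U) : Set where
    field
      preserves-≐ : Preserves σ ≐φ
      preserves-< : Preserves σ <φ
      preserves-Δ : ∀ j → Preserves σ (Δ j)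

  open IsAut

  IsAut-id : IsAut id
  IsAut-id = record
    { preserves-≐ = Preserves-id ; preserves-< = Preserves-id ; preserves-Δ = λ _ → Preserves-id }

  IsAut-∘ : {σ τ : U → U} → IsAut σ → IsAut τ → IsAut (σ ∘ τ)
  IsAut-∘ σ-aut τ-aut = record
    { preserves-≐ = Preserves-∘ (preserves-≐ σ-aut) (preserves-≐ τ-aut)
    ; preserves-< = Preserves-∘ (preserves-< σ-aut) (preserves-< τ-aut)
    ; preserves-Δ = λ j → Preserves-∘ (preserves-Δ σ-aut j) (preserves-Δ τ-aut j)
    }

  IsAut-cong : {σ τ : U → U} → σ ≗ τ → IsAut σ → IsAut τ
  IsAut-cong σ≗τ σ-aut = record
    { preserves-≐ = Preserves-cong σ≗τ (preserves-≐ σ-aut)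
    ; preserves-< = Preserves-cong σ≗τ (preserves-< σ-aut)
    ; preserves-Δ = λ j → Preserves-cong σ≗τ (preserves-Δ σ-aut j)
    }

  IsAut⇒injective : {σ : U → U} → IsAut σ → Injective _≡_ _≡_ σ
  IsAut⇒injective σ-aut {x} {y} = from (Sat-∘ (preserves-≐ σ-aut) (envXY M x λ _ → y))

  autFormula : Formula L U
  autFormula = preservedBy ≐φ ∧f (preservedBy <φ ∧f ⋀ (preservedBy ∘ Δ))

  Sat-autFormula : (σ : U → U) → Sat M σ autFormula ⇔ IsAut σ
  Sat-autFormula σ = mk⇔
    (λ (σ≐ , σ< , σΔ) → record
      { preserves-≐ = to (Sat-preservedBy σ ≐φ) σ≐
      ; preserves-< = to (Sat-preservedBy σ <φ) σ<
      ; preserves-Δ = λ j → to (Sat-preservedBy σ (Δ j)) (to (Sat-⋀ σ _) σΔ j)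
      })
    (λ σ-aut → from (Sat-preservedBy σ ≐φ) (preserves-≐ σ-aut)
             , from (Sat-preservedBy σ <φ) (preserves-< σ-aut)
             , from (Sat-⋀ σ _) λ j → from (Sat-preservedBy σ (Δ j)) (preserves-Δ σ-aut j))

  IsAut? : (σ : U → U) → Dec (IsAut σ)
  IsAut? σ = map′ (to (Sat-autFormula σ)) (from (Sat-autFormula σ)) (Sat? σ autFormula)

  Holds : U → (Fin k → U) → Fin n → Set
  Holds x t j = Sat M (envXY M x t) (Δ j)

  Holds? : ∀ x t j → Dec (Holds x t j)
  Holds? x t j = Sat? (envXY M x t) (Δ j)

  Holds-cong : ∀ {x x′ t t′} j → x ≡ x′ → t ≗ t′ → Holds x t j ⇔ Holds x′ t′ j
  Holds-cong j refl t≗t′ = Sat-cong (λ { (inj₁ _) → refl ; (inj₂ c) → t≗t′ c }) (Δ j)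

  IsAut-Holds : {σ : U → U} → IsAut σ → ∀ x t j → Holds x t j ⇔ Holds (σ x) (σ ∘ t) j
  IsAut-Holds σ-aut x t j = ⇔-trans (Sat-∘ (preserves-Δ σ-aut j) (envXY M x t))
                                    (Sat-cong (λ { (inj₁ _) → refl ; (inj₂ _) → refl }) (Δ j))

  -- σ⁻¹ ∘ τ is <-monotone and moves a strictly upwards.
  IsAut⇒incomparable : IsStrictPO M lt → {σ τ : U → U} → IsAut σ → IsAut τ → ∀ a → ¬ σ a ≺ τ a
  IsAut⇒incomparable (irrefl , <-trans) {σ} {τ} σ-aut τ-aut a σa<τa =
    monotone⇒¬x≺gx irrefl <-trans (σ⁻ ∘ τ)
      (λ {x} {y} x<y → to (σ⁻-< (τ x) (τ y)) (to (τ-< x y) x<y))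
      a (from (σ-< a (σ⁻ (τ a))) (subst (σ a ≺_) (sym (σσ⁻ (τ a))) σa<τa))
    where
      σ-onto : StrictlySurjective _≡_ σ
      σ-onto = injective⇒strictlySurjective (IsAut⇒injective σ-aut)
      σ⁻ : U → U
      σ⁻ = proj₁ ∘ σ-onto
      σσ⁻ : σ ∘ σ⁻ ≗ id
      σσ⁻ = proj₂ ∘ σ-onto
      σ-< : ∀ x y → x ≺ y ⇔ σ x ≺ σ y
      σ-< = <φ-preserved (preserves-< σ-aut)
      τ-< : ∀ x y → x ≺ y ⇔ τ x ≺ τ y
      τ-< = <φ-preserved (preserves-< τ-aut)
      σ⁻-< : ∀ x y → x ≺ y ⇔ σ⁻ x ≺ σ⁻ y
      σ⁻-< = <φ-preserved (Preserves-inverse σσ⁻ (preserves-< σ-aut))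

  keepIf : {V : Set} → Fin 2 → Formula L V → Formula L V
  keepIf zero    φ = ⊥f
  keepIf (suc _) φ = φ

  Sat-keepIf : {V : Set} (ρ : V → U) (s : Fin 2) (φ : Formula L V) →
               Sat M ρ (keepIf s φ) ⇔ (s ≡ suc zero × Sat M ρ φ)
  Sat-keepIf ρ zero       φ = mk⇔ (λ ()) (λ ())
  Sat-keepIf ρ (suc zero) φ = mk⇔ (refl ,_) proj₂

  -- The existential variables x_u (u ∈ U) encode a map σ : u ↦ x_u.  The formula says that σ is an
  -- automorphism, that y_r = σ (par r), and that y is the σ-image of a chosen tuple; read with
  -- par = y_1 … y_d, it says that σ fixes the parameters.
  definingFormula : {d : ℕ} → (Fin d → Fin k → U) → (Fin (N M ^ k) → Fin 2) →
                    Formula L (Fin k ⊎ (Fin d × Fin k))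
  definingFormula par chosen = ∃ⁿ (N M)
    (rename inj₂ autFormula ∧f
      ((⋀ λ r → ⋀ λ c → var (inj₁ (inj₂ (r , c))) ≐ var (inj₂ (par r c))) ∧f
       (⋁ λ u → keepIf (chosen u) (⋀ λ c → var (inj₁ (inj₁ c)) ≐ var (inj₂ (finToFun u c))))))

  AutImageOfChosen : {d : ℕ} → (Fin d → Fin k → U) → (Fin (N M ^ k) → Fin 2) →
                     (Fin k → U) → (Fin d → Fin k → U) → Set
  AutImageOfChosen par chosen b bs =
    ∃ λ σ → IsAut σ × (∀ r c → bs r c ≡ σ (par r c)) ×
            ∃ λ u → chosen u ≡ suc zero × (∀ c → b c ≡ σ (finToFun u c))

  Sat-definingFormula : {d : ℕ} (par : Fin d → Fin k → U) (chosen : Fin (N M ^ k) → Fin 2)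
                        (b : Fin k → U) (bs : Fin d → Fin k → U) →
                        Sat M (envPar M b bs) (definingFormula par chosen) ⇔
                        AutImageOfChosen par chosen b bs
  Sat-definingFormula par chosen b bs = ⇔-trans (Sat-∃ⁿ _ (N M) _) (Σ-⇔ λ σ →
    let ρ = [ envPar M b bs , σ ] in
    Sat-autFormula σ ⇔-∘ Sat-rename inj₂ (λ _ → refl) autFormula
    ×-⇔ Π-⇔ (λ r → Sat-⋀ ρ _) ⇔-∘ Sat-⋀ ρ _
    ×-⇔ Σ-⇔ (λ u → (⇔-refl ×-⇔ Sat-⋀ ρ _) ⇔-∘ Sat-keepIf ρ (chosen u) _) ⇔-∘ Sat-⋁ ρ _)

  -- A member of the family is coded by the parameter positions par and, for each j, the set of
  -- chosen tuples (as a function Fin (|M| ^ k) → Fin 2).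
  familySize : ℕ → ℕ
  familySize d = (N M ^ k) ^ d * (2 ^ (N M ^ k)) ^ n

  family : {d : ℕ} → Fin (familySize d) → Fin n → Formula L (Fin k ⊎ (Fin d × Fin k))
  family {d} i j = definingFormula (decode₂ (proj₁ code)) (decode₂ (proj₂ code) j)
    where code = remQuot {(N M ^ k) ^ d} ((2 ^ (N M ^ k)) ^ n) i

  familyIndex : {d : ℕ} → (Fin d → Fin k → U) → (Fin n → Fin (N M ^ k) → Fin 2) →
                Fin (familySize d)
  familyIndex par chosen = combine (encode₂ par) (encode₂ chosen)

  module _ {d : ℕ} (par : Fin d → Fin k → U) (chosen : Fin n → Fin (N M ^ k) → Fin 2) where

    private
      code = remQuot {(N M ^ k) ^ d} ((2 ^ (N M ^ k)) ^ n) (familyIndex par chosen)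

    familyIndex-par : ∀ r c → decode₂ (proj₁ code) r c ≡ par r c
    familyIndex-par r c =
      trans (cong (λ code → decode₂ (proj₁ code) r c) (remQuot-combine (encode₂ par) (encode₂ chosen)))
            (decode₂-encode₂ par r c)

    familyIndex-chosen : ∀ j u → decode₂ (proj₂ code) j u ≡ chosen j u
    familyIndex-chosen j u =
      trans (cong (λ code → decode₂ (proj₂ code) j u) (remQuot-combine (encode₂ par) (encode₂ chosen)))
            (decode₂-encode₂ chosen j u)

  module Orbits (a : U) (B : List (Fin k → U)) where

    Index : Set
    Index = Fin (length B)

    tuple : Index → Fin k → U
    tuple = List.lookup B

    Fixes : (U → U) → Index → Set
    Fixes σ i = σ ∘ tuple i ≗ tuple i

    Stab : List Index → (U → U) → Set
    Stab ps σ = IsAut σ × All (Fixes σ) ps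

    Stab? : ∀ ps σ → Dec (Stab ps σ)
    Stab? ps σ = IsAut? σ ×-dec All.all? (λ i → all? λ c → σ (tuple i c) ≟ tuple i c) ps

    Stab-id : ∀ ps → Stab ps id
    Stab-id ps = IsAut-id , All.tabulate λ _ _ → refl

    Stab-∘ : ∀ {ps σ τ} → Stab ps σ → Stab ps τ → Stab ps (σ ∘ τ)
    Stab-∘ {σ = σ} (σ-aut , σ-fixes) (τ-aut , τ-fixes) =
      IsAut-∘ σ-aut τ-aut , All.zipWith (λ (σi , τi) c → trans (cong σ (τi c)) (σi c)) (σ-fixes , τ-fixes)

    Stab-cong : ∀ {ps σ τ} → σ ≗ τ → Stab ps σ → Stab ps τ
    Stab-cong σ≗τ (σ-aut , σ-fixes) =
      IsAut-cong σ≗τ σ-aut , All.map (λ σi c → trans (sym (σ≗τ _)) (σi c)) σ-fixes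

    Orbit : List Index → U → Set
    Orbit ps x = ∃ λ σ → Stab ps σ × σ a ≡ x

    Orbit? : ∀ ps x → Dec (Orbit ps x)
    Orbit? ps x = anyFunction?
      (λ σ≗τ (σ-stab , σa≡x) → Stab-cong σ≗τ σ-stab , trans (sym (σ≗τ a)) σa≡x)
      (λ σ → Stab? ps σ ×-dec σ a ≟ x)

    orbitSize : List Index → ℕ
    orbitSize ps = count (Orbit? ps)

    Invariant : List Index → Set
    Invariant ps = ∀ {σ} → Stab ps σ → ∀ i i′ → σ ∘ tuple i ≗ tuple i′ →
                   ∀ j → Holds a (tuple i) j → Holds a (tuple i′) j

    Invariant-mono : ∀ {ps qs} → ps ⊆ qs → Invariant ps → Invariant qs
    Invariant-mono ps⊆qs inv (σ-aut , σ-fixes) = inv (σ-aut , All.anti-mono ps⊆qs σ-fixes)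

    Separates : Index → Index → Set
    Separates i i′ = ∃ λ j → Holds a (tuple i) j × ¬ Holds a (tuple i′) j

    Separates? : ∀ i i′ → Dec (Separates i i′)
    Separates? i i′ = any? λ j → Holds? a (tuple i) j ×-dec ¬? (Holds? a (tuple i′) j)

    SplitBy : List Index → (U → U) → Set
    SplitBy ps σ = Stab ps σ × ∃ λ i → ∃ λ i′ → σ ∘ tuple i ≗ tuple i′ × Separates i i′

    SplitBy? : ∀ ps σ → Dec (SplitBy ps σ)
    SplitBy? ps σ = Stab? ps σ ×-dec any? λ i → any? λ i′ →
                    all? (λ c → σ (tuple i c) ≟ tuple i′ c) ×-dec Separates? i i′

    SplitBy-cong : ∀ {ps σ τ} → σ ≗ τ → SplitBy ps σ → SplitBy ps τ
    SplitBy-cong σ≗τ (σ-stab , i , i′ , σi≗i′ , sep) =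
      Stab-cong σ≗τ σ-stab , i , i′ , (λ c → trans (sym (σ≗τ _)) (σi≗i′ c)) , sep

    invariantOrSplit : ∀ ps → Invariant ps ⊎ ∃ (SplitBy ps)
    invariantOrSplit ps with anyFunction? SplitBy-cong (SplitBy? ps)
    ... | yes split = inj₂ split
    ... | no ¬split = inj₁ λ {σ} σ-stab i i′ σi≗i′ j holds →
      decidable-stable (Holds? a (tuple i′) j) λ fails →
        ¬split (σ , σ-stab , i , i′ , σi≗i′ , j , holds , fails)

    -- The orbit of a under Stab ps splits along the truth value of Δ j (x; tuple i′).  The part
    -- where it holds contains the σ-image of the orbit under Stab (i ∷ ps), the other part
    -- contains the orbit under Stab (i′ ∷ ps).
    halving : ∀ {ps σ i i′ j} → Stab ps σ → σ ∘ tuple i ≗ tuple i′ →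
              Holds a (tuple i) j → ¬ Holds a (tuple i′) j →
              orbitSize (i ∷ ps) + orbitSize (i′ ∷ ps) ≤ orbitSize ps
    halving {ps} {σ} {i} {i′} {j} σ-stab@(σ-aut , _) σi≗i′ holds fails =
      subst (orbitSize (i ∷ ps) + orbitSize (i′ ∷ ps) ≤_)
            (sym (count-split (Orbit? ps) λ x → Holds? x (tuple i′) j))
            (+-mono-≤ (≤-trans orbit-i⊆holds-i holds-i↪holds-i′) orbit-i′⊆fails-i′)
      where
        orbit-i⊆holds-i : orbitSize (i ∷ ps) ≤ count (λ x → Orbit? ps x ×-dec Holds? x (tuple i) j)
        orbit-i⊆holds-i = count-mono (Orbit? (i ∷ ps)) _
          λ { (τ , (τ-aut , τi ∷ τ-fixes) , τa≡x) → (τ , (τ-aut , τ-fixes) , τa≡x)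
                , to (Holds-cong j τa≡x τi) (to (IsAut-Holds τ-aut a (tuple i) j) holds) }
        holds-i↪holds-i′ : count (λ x → Orbit? ps x ×-dec Holds? x (tuple i) j)
                         ≤ count (λ x → Orbit? ps x ×-dec Holds? x (tuple i′) j)
        holds-i↪holds-i′ = count-injective _ _ σ (IsAut⇒injective σ-aut)
          λ { {x} ((τ , τ-stab , τa≡x) , hx) → (σ ∘ τ , Stab-∘ σ-stab τ-stab , cong σ τa≡x)
                , to (Holds-cong j refl σi≗i′) (to (IsAut-Holds σ-aut x (tuple i) j) hx) }
        orbit-i′⊆fails-i′ : orbitSize (i′ ∷ ps)
                          ≤ count (λ x → Orbit? ps x ×-dec ¬? (Holds? x (tuple i′) j))
        orbit-i′⊆fails-i′ = count-mono (Orbit? (i′ ∷ ps)) _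
          λ { (τ , (τ-aut , τi′ ∷ τ-fixes) , τa≡x) → (τ , (τ-aut , τ-fixes) , τa≡x)
                , λ hx → fails (from (IsAut-Holds τ-aut a (tuple i′) j)
                                     (from (Holds-cong j τa≡x τi′) hx)) }

    trivialOrbit⇒invariant : ∀ {ps} → orbitSize ps < 2 → Invariant ps
    trivialOrbit⇒invariant {ps} trivial {σ} σ-stab i i′ σi≗i′ j holds =
      to (Holds-cong j σa≡a σi≗i′) (to (IsAut-Holds (proj₁ σ-stab) a (tuple i) j) holds)
      where
        σa≡a : σ a ≡ a
        σa≡a = decidable-stable (σ a ≟ a) λ σa≢a → <-irrefl refl (≤-<-trans
          (unique⇒length≤count (Orbit? ps) ((σa≢a ∷ []) ∷ [] ∷ [])
                                           ((σ , σ-stab , refl) ∷ (id , Stab-id ps , refl) ∷ []))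
          trivial)

    addParameter : ∀ {r ps} i → ∃ (λ (is : Vec Index r) → Invariant (Vec.toList is ++ i ∷ ps)) →
                   ∃ λ (is : Vec Index (suc r)) → Invariant (Vec.toList is ++ ps)
    addParameter {ps = ps} i (is , invariant) =
      i ∷ is , Invariant-mono (∈-resp-↭ (↭-shift i (Vec.toList is) ps)) invariant

    -- Parameters are only needed while the orbit splits; the unused ones are padded with i₀.
    chooseParameters : ∀ r ps → orbitSize ps < 2 ^ suc r → Index →
                       ∃ λ (is : Vec Index r) → Invariant (Vec.toList is ++ ps)
    chooseParameters zero    ps trivial i₀ = [] , trivialOrbit⇒invariant trivial
    chooseParameters (suc r) ps small   i₀ with invariantOrSplit ps
    ... | inj₁ invariant = Vec.replicate (suc r) i₀ , Invariant-mono (∈-++⁺ʳ _) invariant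
    ... | inj₂ (σ , σ-stab , i , i′ , σi≗i′ , j , holds , fails)
          with m+n<2*o⇒m<o⊎n<o (2 ^ suc r) (≤-<-trans (halving σ-stab σi≗i′ holds fails) small)
    ...   | inj₁ smaller = addParameter i (chooseParameters r (i ∷ ps) smaller i₀)
    ...   | inj₂ smaller = addParameter i′ (chooseParameters r (i′ ∷ ps) smaller i₀)

    orbitSize≤width : IsStrictPO M lt → ∀ w → WidthAtMost M lt w → orbitSize [] ≤ w
    orbitSize≤width po _ width = width (filter (Orbit? []) (allFin _))
      (Unique.filter⁺ (Orbit? []) (Unique.allFin⁺ _))
      (All⇒AllPairs incomparable (all-filter (Orbit? []) (allFin _)))
      where
        incomparable : ∀ {x y} → Orbit [] x → Orbit [] y → Incomparable M lt x y
        incomparable (σ , (σ-aut , []) , refl) (τ , (τ-aut , []) , refl) =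
          IsAut⇒incomparable po σ-aut τ-aut a , IsAut⇒incomparable po τ-aut σ-aut a

    Chosen : Fin n → (Fin k → U) → Set
    Chosen j t = (∃ λ i → tuple i ≗ t) × Holds a t j

    Chosen? : ∀ j t → Dec (Chosen j t)
    Chosen? j t = any? (λ i → all? λ c → tuple i c ≟ t c) ×-dec Holds? a t j

    chosenTuples : Fin n → Fin (N M ^ k) → Fin 2
    chosenTuples j u = toBit (Chosen? j (finToFun u))

    parameters : {d : ℕ} → Vec Index d → Fin d → Fin k → U
    parameters is r = tuple (Vec.lookup is r)

    module _ {d : ℕ} (is : Vec Index d) (invariant : Invariant (Vec.toList is)) where

      definesType : {par : Fin d → Fin k → U} {chosen : Fin n → Fin (N M ^ k) → Fin 2} →
                    (∀ r c → par r c ≡ parameters is r c) → (∀ j u → chosen j u ≡ chosenTuples j u) →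
                    ∀ j → All (λ b → Holds a b j ⇔ Sat M (envPar M b (parameters is))
                                                        (definingFormula par (chosen j))) B
      definesType {par} {chosen} par≗ chosen≗ j = All.tabulate λ {b} b∈B →
        let i = Any.index b∈B
            b≗i : b ≗ tuple i
            b≗i c = cong (λ t → t c) (lookup-index b∈B)
        in ⇔-trans (mk⇔ (complete i b≗i) (sound i b≗i))
                   (⇔-sym (Sat-definingFormula par (chosen j) b (parameters is)))
        where
          sound : ∀ i {b} → b ≗ tuple i → AutImageOfChosen par (chosen j) b (parameters is) → Holds a b j
          sound i b≗i (σ , σ-aut , fixes , u , chosen≡1 , b≗σu)
            with (i₀ , i₀≗u) , holds-u ← toBit-sound _ (trans (sym (chosen≗ j u)) chosen≡1) =
            to (Holds-cong j refl (sym ∘ b≗i)) (invariant (σ-aut , σ-fixes) i₀ i σi₀≗i j holds-i₀)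
            where
              holds-i₀ : Holds a (tuple i₀) j
              holds-i₀ = from (Holds-cong j refl i₀≗u) holds-u
              σi₀≗i : σ ∘ tuple i₀ ≗ tuple i
              σi₀≗i c = trans (cong σ (i₀≗u c)) (trans (sym (b≗σu c)) (b≗i c))
              σ-fixes : All (Fixes σ) (Vec.toList is)
              σ-fixes = VecAll.toList⁺ (VecAll.lookup⁻ λ r c →
                trans (cong σ (sym (par≗ r c))) (sym (fixes r c)))
          complete : ∀ i {b} → b ≗ tuple i → Holds a b j → AutImageOfChosen par (chosen j) b (parameters is)
          complete i {b} b≗i holds =
            id , IsAut-id , (λ r c → sym (par≗ r c)) , u , chosen≡1 , (sym ∘ finToFun-funToFin b)
            where
              u : Fin (N M ^ k)
              u = funToFin b
              chosen≡1 : chosen j u ≡ suc zero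
              chosen≡1 = trans (chosen≗ j u) (toBit-complete _
                ((i , λ c → trans (sym (b≗i c)) (sym (finToFun-funToFin b c)))
                , to (Holds-cong j refl (sym ∘ finToFun-funToFin b)) holds))

corollary3p4 : (d : ℕ) (L : Language) (lt : Rel L 2) (M : Structure L) →
               IsStrictPO M lt → WidthAtMost M lt (2 ^ suc d ∸ 1) →
               VCd M d
corollary3p4 d L lt M po width k n Δ = familySize d , family , λ B 0<|B| q (a , a-realizes-q) →
  let open Orbits a B
      orbit-small : orbitSize [] < 2 ^ suc d
      orbit-small = ≤-<-trans (orbitSize≤width po _ width) (∸-monoʳ-< z<s (m^n>0 2 (suc d)))
      (is , invariant) = chooseParameters d [] orbit-small (fromℕ< 0<|B|)
      par = parameters is
      defines = definesType is (subst Invariant (++-identityʳ (Vec.toList is)) invariant)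
                  (familyIndex-par par chosenTuples) (familyIndex-chosen par chosenTuples)
  in Vec.lookup is , familyIndex par chosenTuples ,
     λ j → All.zipWith (uncurry ⇔-trans) (a-realizes-q j , defines j)
  where
    open Reduct M lt Δ
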